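{- Let $\mathcal{C}$ be a finite collection of boxes in $\mathbb{R}^3$ of the form $[x_1,x_1+p_1]\times[x_2,x_2+p_2]\times[x_3,x_3+p_3]$ with $x_i\in\mathbb{Z}$ and all side lengths $p_i$ odd positive integers (different boxes may have different side lengths), with pairwise disjoint interiors. Then the contact graph of $\mathcal{C}$ (vertices the boxes, an edge between two boxes whose intersection is a non-degenerate two-dimensional rectangle) is $8$-colorable. -}

module Defs where

open import Data.Nat as ℕ using (ℕ; suc)
open import Data.Integer as ℤ using (ℤ; +_)
open import Data.Fin using (Fin)
open import Data.Product using (Σ; ∃; _×_)
open import Data.Sum using (_⊎_)
open import Relation.Binary.PropositionalEquality using (_≡_; _≢_)

Odd : ℕ → Set
Odd n = Σ ℕ λ m → n ≡ suc (2 ℕ.* m)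

-- box [x₁,x₁+p₁]×[x₂,x₂+p₂]×[x₃,x₃+p₃] in ℝ³, x ∈ ℤ³, p ∈ ℕ³
record Box : Set where
  field
    corner : Fin 3 → ℤ
    side   : Fin 3 → ℕ

open Box public

lo hi : Box → Fin 3 → ℤ
lo b k = corner b k
hi b k = corner b k ℤ.+ + side b k

OddBox : Box → Set
OddBox b = ∀ k → Odd (side b k)

-- interiors (products of open intervals (lo,hi)) are disjoint
-- iff in some coordinate the open intervals are disjoint
DisjointInteriors : Box → Box → Set
DisjointInteriors a b = ∃ λ k → (hi a k ℤ.≤ lo b k) ⊎ (hi b k ℤ.≤ lo a k)

-- intersection a ∩ b = ∏ₖ [max lo, min hi]; it is a non-degenerate
-- 2-dimensional rectangle iff exactly one coordinate is degenerate
-- (a single point) and the other two have positive length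
Contact : Box → Box → Set
Contact a b = ∃ λ k →
  ((lo a k ℤ.⊔ lo b k) ≡ (hi a k ℤ.⊓ hi b k)) ×
  (∀ j → j ≢ k → (lo a j ℤ.⊔ lo b j) ℤ.< (hi a j ℤ.⊓ hi b j))

{-# OPTIONS --safe #-}
-- Colour each box by the parities of its three corner coordinates.  If two
-- boxes touch along a face orthogonal to direction k, their k-th intervals
-- [x, x+p] and [y, y+q] meet in the single point max(x,y) = min(x+p,y+q).
-- As a max it has the parity of x or of y, as a min that of x+p or of y+q;
-- were x and y of equal parity, oddness of p and q would give the point both
-- parities.
module Submission where

open import Defs
open import Data.Nat using (ℕ; zero; suc; _*_; parity)
open import Data.Fin as Fin using (Fin; funToFin; finToFun)
open import Data.Fin.Properties using (finToFun-funToFin)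
open import Data.Integer as ℤ using (ℤ; +_; -[1+_]; ∣_∣; _⊔_; _⊓_)
open import Data.Integer.Properties using (⊔-sel; ⊓-sel; suc-+; +-comm; +-identityʳ)
open import Data.Parity.Base as ℙ using (Parity; 0ℙ; 1ℙ; _⁻¹)
open import Data.Parity.Properties
  using (⁻¹-selfInverse; ⁻¹-involutive; p≢p⁻¹; suc-homo-⁻¹; *-homo-*)
open import Data.Product using (Σ; _,_)
open import Data.Sum using (inj₁; inj₂)
open import Algebra.Definitions using (Selective)
open import Function using (_∘_)
open import Function.Definitions using (Injective)
open import Relation.Binary.PropositionalEquality

private
  variable
    A B : Set
    n p q : ℕ

sel⇒common-value : {_∙_ : A → A → A} → Selective _≡_ _∙_ →
                   (f : A → B) → ∀ x y → f x ≡ f y → f (x ∙ y) ≡ f x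
sel⇒common-value sel f x y fx≡fy with sel x y
... | inj₁ x∙y≡x = cong f x∙y≡x
... | inj₂ x∙y≡y = trans (cong f x∙y≡y) (sym fx≡fy)

[p+q]⁻¹≡p⁻¹+q : ∀ p q → (p ℙ.+ q) ⁻¹ ≡ p ⁻¹ ℙ.+ q
[p+q]⁻¹≡p⁻¹+q 0ℙ q = refl
[p+q]⁻¹≡p⁻¹+q 1ℙ q = ⁻¹-involutive q

parity-suc : ∀ n → parity (suc n) ≡ parity n ⁻¹
parity-suc n = sym (⁻¹-selfInverse (suc-homo-⁻¹ n))

odd⇒parity≡1ℙ : Odd n → parity n ≡ 1ℙ
odd⇒parity≡1ℙ (m , refl) = trans (parity-suc (2 * m)) (cong _⁻¹ (*-homo-* 2 m))

parityℤ : ℤ → Parity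
parityℤ i = parity ∣ i ∣

parityℤ-suc : ∀ i → parityℤ (ℤ.suc i) ≡ parityℤ i ⁻¹
parityℤ-suc (+ n)        = parity-suc n
parityℤ-suc -[1+ zero ]  = refl
parityℤ-suc -[1+ suc n ] = sym (suc-homo-⁻¹ (suc n))

i+[1+n]≡suc[i+n] : ∀ i n → i ℤ.+ + suc n ≡ ℤ.suc (i ℤ.+ + n)
i+[1+n]≡suc[i+n] i n = begin
  i ℤ.+ + suc n      ≡⟨ +-comm i _ ⟩
  + suc n ℤ.+ i      ≡⟨ suc-+ n i ⟩
  ℤ.suc (+ n ℤ.+ i)  ≡⟨ cong ℤ.suc (+-comm (+ n) i) ⟩
  ℤ.suc (i ℤ.+ + n)  ∎
  where open ≡-Reasoning

parityℤ-+ : ∀ i n → parityℤ (i ℤ.+ + n) ≡ parity n ℙ.+ parityℤ i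
parityℤ-+ i zero    = cong parityℤ (+-identityʳ i)
parityℤ-+ i (suc n) = begin
  parityℤ (i ℤ.+ + suc n)       ≡⟨ cong parityℤ (i+[1+n]≡suc[i+n] i n) ⟩
  parityℤ (ℤ.suc (i ℤ.+ + n))   ≡⟨ parityℤ-suc (i ℤ.+ + n) ⟩
  parityℤ (i ℤ.+ + n) ⁻¹        ≡⟨ cong _⁻¹ (parityℤ-+ i n) ⟩
  (parity n ℙ.+ parityℤ i) ⁻¹   ≡⟨ [p+q]⁻¹≡p⁻¹+q (parity n) (parityℤ i) ⟩
  parity n ⁻¹ ℙ.+ parityℤ i     ≡⟨ cong (ℙ._+ parityℤ i) (sym (parity-suc n)) ⟩
  parity (suc n) ℙ.+ parityℤ i  ∎
  where open ≡-Reasoning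

parityℤ-+-odd : ∀ i → Odd n → parityℤ (i ℤ.+ + n) ≡ parityℤ i ⁻¹
parityℤ-+-odd {n} i odd =
  trans (parityℤ-+ i n) (cong (ℙ._+ parityℤ i) (odd⇒parity≡1ℙ odd))

singlePointOverlap⇒parityℤ≢ : {x y : ℤ} → Odd p → Odd q →
  x ⊔ y ≡ (x ℤ.+ + p) ⊓ (y ℤ.+ + q) → parityℤ x ≢ parityℤ y
singlePointOverlap⇒parityℤ≢ {p} {q} {x} {y} oddp oddq touch same =
  p≢p⁻¹ (parityℤ x) (begin
    parityℤ x          ≡⟨ sym (sel⇒common-value ⊔-sel parityℤ x y same) ⟩
    parityℤ (x ⊔ y)    ≡⟨ cong parityℤ touch ⟩
    parityℤ (x′ ⊓ y′)  ≡⟨ sel⇒common-value ⊓-sel parityℤ x′ y′ sameUpper ⟩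
    parityℤ x′         ≡⟨ parityℤ-+-odd x oddp ⟩
    parityℤ x ⁻¹       ∎)
  where
  open ≡-Reasoning
  x′ y′ : ℤ
  x′ = x ℤ.+ + p
  y′ = y ℤ.+ + q
  sameUpper : parityℤ x′ ≡ parityℤ y′
  sameUpper = trans (parityℤ-+-odd x oddp)
                (trans (cong _⁻¹ same) (sym (parityℤ-+-odd y oddq)))

parityToFin : Parity → Fin 2
parityToFin 0ℙ = Fin.zero
parityToFin 1ℙ = Fin.suc Fin.zero

parityToFin-injective : Injective _≡_ _≡_ parityToFin
parityToFin-injective {0ℙ} {0ℙ} _ = refl
parityToFin-injective {1ℙ} {1ℙ} _ = refl

cornerParities : Box → Fin 3 → Fin 2
cornerParities b k = parityToFin (parityℤ (lo b k))

colour : Box → Fin 8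
colour = funToFin ∘ cornerParities

colour≡⇒cornerParity≡ : ∀ a b → colour a ≡ colour b →
                         ∀ k → parityℤ (lo a k) ≡ parityℤ (lo b k)
colour≡⇒cornerParity≡ a b same k = parityToFin-injective (begin
  cornerParities a k     ≡⟨ sym (finToFun-funToFin (cornerParities a) k) ⟩
  finToFun (colour a) k  ≡⟨ cong (λ c → finToFun c k) same ⟩
  finToFun (colour b) k  ≡⟨ finToFun-funToFin (cornerParities b) k ⟩
  cornerParities b k     ∎)
  where open ≡-Reasoning

corollary5p4 : (n : ℕ) (C : Fin n → Box) →
    (∀ i → OddBox (C i)) →
    (∀ i j → i ≢ j → DisjointInteriors (C i) (C j)) →
    Σ (Fin n → Fin 8) λ col → ∀ i j → Contact (C i) (C j) → col i ≢ col j
corollary5p4 n C odd _ = colour ∘ C , separated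
  where
  separated : ∀ i j → Contact (C i) (C j) → colour (C i) ≢ colour (C j)
  separated i j (k , touch , _) same =
    singlePointOverlap⇒parityℤ≢ (odd i k) (odd j k) touch
      (colour≡⇒cornerParity≡ (C i) (C j) same k)
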